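{- Let $F$ be a positive integer that is not a multiple of $3$. Then the number of maximal embedding dimension numerical semigroups with multiplicity $3$ and Frobenius number $F$ equals $\left\lfloor\frac{F+1}{3}\right\rfloor - \left\lceil \frac{F+2}{6} \right\rceil + 1$.
   Context: A numerical semigroup is a subset $S \subseteq \mathbb{N}$ containing $0$, closed under addition, with $\mathbb{N}\setminus S$ finite. Its multiplicity is $\mathrm{m}(S)=\min(S\setminus\{0\})$, its Frobenius number is the largest integer not in $S$, and its embedding dimension is the cardinality of its (unique) minimal system of generators. $S$ is a maximal embedding dimension (MED) numerical semigroup if its embedding dimension equals its multiplicity. -}

module Defs where

open import Data.Nat using (ℕ; zero; suc; _+_; _*_; _∸_; _≤_; _<_)
open import Data.Nat.DivMod using (_/_)
open import Data.Bool using (Bool; true; false)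
open import Data.List using (List; length)
open import Data.List.Membership.Propositional using (_∈_)
open import Data.List.Relation.Unary.All using (All)
open import Data.List.Relation.Unary.Any using (Any)
open import Data.List.Relation.Unary.AllPairs using (AllPairs)
open import Data.Product using (Σ; ∃; _×_)
open import Relation.Nullary using (¬_)
open import Relation.Binary.PropositionalEquality using (_≡_; _≢_)

-- A subset of ℕ, given by its (decidable) membership function.
-- (Numerical semigroups are cofinite, hence always decidable.)
Subset : Set
Subset = ℕ → Bool

_∈S_ : ℕ → Subset → Set
n ∈S S = S n ≡ true

_≈S_ : Subset → Subset → Set
S ≈S T = ∀ n → S n ≡ T n

record IsNumericalSemigroup (S : Subset) : Set where
  field
    zero∈  : 0 ∈S S
    closed : ∀ a b → a ∈S S → b ∈S S → (a + b) ∈S S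
    cofinite : ∃ λ N → ∀ n → N ≤ n → n ∈S S

data Gen (A : ℕ → Set) : ℕ → Set where
  gzero : Gen A 0
  gadd  : ∀ {a n} → A a → Gen A n → Gen A (a + n)

Generates : Subset → (ℕ → Set) → Set
Generates S A = ∀ n → (n ∈S S → Gen A n) × (Gen A n → n ∈S S)

-- The finite set of elements of the list gs (no repetitions) is a minimal
-- system of generators of S: it generates S and no proper subset does
-- (equivalently, removing any single element destroys generation).
IsMinimalSystemOfGenerators : Subset → List ℕ → Set
IsMinimalSystemOfGenerators S gs =
  AllPairs _≢_ gs ×
  Generates S (λ n → n ∈ gs) ×
  (∀ x → x ∈ gs → ¬ Generates S (λ n → n ∈ gs × n ≢ x))

EmbeddingDimension : Subset → ℕ → Set
EmbeddingDimension S e = Σ (List ℕ) λ gs → IsMinimalSystemOfGenerators S gs × length gs ≡ e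

Multiplicity : Subset → ℕ → Set
Multiplicity S m = 0 < m × m ∈S S × (∀ k → 0 < k → k < m → S k ≡ false)

FrobeniusNumber : Subset → ℕ → Set
FrobeniusNumber S F = S F ≡ false × (∀ n → F < n → n ∈S S)

IsMED : Subset → Set
IsMED S = ∃ λ m → Multiplicity S m × EmbeddingDimension S m

IsMED3Frob : ℕ → Subset → Set
IsMED3Frob F S = IsNumericalSemigroup S × IsMED S × Multiplicity S 3 × FrobeniusNumber S F

NumberOf : (Subset → Set) → ℕ → Set
NumberOf P k = Σ (List Subset) λ Ls →
  length Ls ≡ k ×
  All P Ls ×
  AllPairs (λ S T → ¬ (S ≈S T)) Ls ×
  (∀ S → P S → Any (λ T → S ≈S T) Ls)

ceilDiv6 : ℕ → ℕ
ceilDiv6 a = (a + 5) / 6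

module Submission where

-- A numerical semigroup S of multiplicity 3 is determined by its Apéry set {0, a, b} of 3, where
-- a and b are the least elements of S congruent to 1 and 2 modulo 3: n ∈ S iff n is at least
-- the Apéry element of its class. Such a set is closed under addition iff b ≤ 2a and a ≤ 2b; S has
-- embedding dimension 3 iff both inequalities are strict (if a = 2b, then S is generated by its
-- two atoms 3 and b); and its Frobenius number is max(a, b) − 3. Hence if F ≡ 1 (resp. 2) modulo 3,
-- the semigroups in question have Apéry set {0, F + 3, w} (resp. {0, w, F + 3}) with w in the
-- remaining class and (F + 3)/2 < w < F + 3. Writing F + 3 = 2c + 3m with m = ⌊(F + 1)/3⌋ and
-- c ∈ {1, 2} the class of w, these are w = c + 3j with m/2 < j ≤ m: there are m − ⌊m/2⌋ of them,
-- and ⌈(F + 2)/6⌉ = ⌊m/2⌋ + 1.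

open import Defs
open import Data.Nat using (ℕ; _+_; _∸_; _<_)
open import Data.Nat.DivMod using (_/_; _%_)
open import Relation.Binary.PropositionalEquality using (_≢_)

open import Data.Nat using (zero; suc; _*_; _≤_; _≤ᵇ_; z≤n; s≤s; _≟_; NonZero)
open import Data.Nat.Properties
open import Data.Nat.DivMod
  using (m≡m%n+[m/n]*n; m%n<n; m<n*o⇒m/o<n; m*n%n≡0; m*n/n≡m; m/n≤m; m/n/o≡m/[n*o]; /-congˡ; +-distrib-/-∣ʳ)
open import Data.Nat.Divisibility using (divides)
open import Data.Nat.Induction using (<-rec)
open import Data.Nat.Tactic.RingSolver using (solve-∀)
open import Data.Bool using (true; false)
open import Data.Bool.Properties using (T-≡; ¬-not; not-¬; ⇔→≡)
import Data.Bool.Properties as Bool using (_≟_)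
open import Data.Empty using (⊥-elim)
open import Data.Product using (∃; ∃₂; _×_; _,_; proj₁; proj₂)
open import Data.Sum using (_⊎_; inj₁; inj₂)
open import Data.List using (List; []; _∷_; applyUpTo)
open import Data.List.Properties using (length-applyUpTo)
open import Data.List.Membership.Propositional using (_∈_)
open import Data.List.Relation.Unary.Any using (here; there)
import Data.List.Relation.Unary.All.Properties as All
import Data.List.Relation.Unary.Any.Properties as Any
import Data.List.Relation.Unary.AllPairs.Properties as AllPairs
open import Data.List.Relation.Unary.AllPairs using (AllPairs; []; _∷_)
open import Data.List.Relation.Unary.All using ([]; _∷_)
open import Function using (_∘_)
open import Function.Bundles using (_⇔_; mk⇔; Equivalence)
open import Relation.Nullary using (¬_; yes; no)
open import Relation.Binary using (tri<; tri≈; tri>)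
open import Relation.Unary using (Decidable)
open import Relation.Binary.PropositionalEquality
  using (_≡_; refl; sym; trans; cong; cong₂; subst; module ≡-Reasoning)

data ℤ₃ : Set where
  0₃ 1₃ 2₃ : ℤ₃

_+₃_ : ℤ₃ → ℤ₃ → ℤ₃
0₃ +₃ σ  = σ
1₃ +₃ 0₃ = 1₃
1₃ +₃ 1₃ = 2₃
1₃ +₃ 2₃ = 0₃
2₃ +₃ 0₃ = 2₃
2₃ +₃ 1₃ = 0₃
2₃ +₃ 2₃ = 1₃

+₃-identityʳ : ∀ ρ → ρ +₃ 0₃ ≡ ρ
+₃-identityʳ 0₃ = refl
+₃-identityʳ 1₃ = refl
+₃-identityʳ 2₃ = refl

+₃-identityʳ-unique : ∀ ρ σ → ρ +₃ σ ≡ ρ → σ ≡ 0₃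
+₃-identityʳ-unique 0₃ σ  eq = eq
+₃-identityʳ-unique 1₃ 0₃ _  = refl
+₃-identityʳ-unique 2₃ 0₃ _  = refl
+₃-identityʳ-unique 1₃ 1₃ ()
+₃-identityʳ-unique 1₃ 2₃ ()
+₃-identityʳ-unique 2₃ 1₃ ()
+₃-identityʳ-unique 2₃ 2₃ ()

rep : ℤ₃ → ℕ
rep 0₃ = 0
rep 1₃ = 1
rep 2₃ = 2

res : ℕ → ℤ₃
res 0 = 0₃
res 1 = 1₃
res 2 = 2₃
res (suc (suc (suc n))) = res n

res-rep : ∀ ρ → res (rep ρ) ≡ ρ
res-rep 0₃ = refl
res-rep 1₃ = refl
res-rep 2₃ = refl

res-suc : ∀ n → res (suc n) ≡ 1₃ +₃ res n
res-suc 0 = refl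
res-suc 1 = refl
res-suc 2 = refl
res-suc (suc (suc (suc n))) = res-suc n

res-+ : ∀ m n → res (m + n) ≡ res m +₃ res n
res-+ 0 n = refl
res-+ 1 n = res-suc n
res-+ 2 n = trans (trans (res-suc (suc n)) (cong (1₃ +₃_) (res-suc n))) (twice-1₃ (res n))
  where
  twice-1₃ : ∀ ρ → 1₃ +₃ (1₃ +₃ ρ) ≡ 2₃ +₃ ρ
  twice-1₃ 0₃ = refl
  twice-1₃ 1₃ = refl
  twice-1₃ 2₃ = refl
res-+ (suc (suc (suc m))) n = res-+ m n

res-*3 : ∀ k → res (k * 3) ≡ 0₃
res-*3 zero    = refl
res-*3 (suc k) = res-*3 k

res-+*3 : ∀ n k → res (n + k * 3) ≡ res n
res-+*3 n k = begin
  res (n + k * 3)        ≡⟨ res-+ n (k * 3) ⟩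
  res n +₃ res (k * 3)   ≡⟨ cong (res n +₃_) (res-*3 k) ⟩
  res n +₃ 0₃            ≡⟨ +₃-identityʳ (res n) ⟩
  res n                  ∎
  where open ≡-Reasoning

res-view : ∀ n → ∃ λ k → n ≡ rep (res n) + k * 3
res-view 0 = 0 , refl
res-view 1 = 0 , refl
res-view 2 = 0 , refl
res-view (suc (suc (suc n))) with res-view n
... | k , n≡ = suc k , trans (cong (3 +_) n≡) (shift (rep (res n)) (k * 3))
  where
  shift : ∀ r x → 3 + (r + x) ≡ r + (3 + x)
  shift = solve-∀

res≡⇒rep+*3 : ∀ {n ρ} → res n ≡ ρ → ∃ λ k → n ≡ rep ρ + k * 3
res≡⇒rep+*3 {n} refl = res-view n

res≡⇒+*3 : ∀ {m n} → res m ≡ res n → m ≤ n → ∃ λ k → n ≡ m + k * 3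
res≡⇒+*3 {m} {n} res≡ m≤n
  with res≡⇒rep+*3 {n ∸ m} (+₃-identityʳ-unique (res m) (res (n ∸ m)) res-m+d≡)
  where
  res-m+d≡ : res m +₃ res (n ∸ m) ≡ res m
  res-m+d≡ = trans (sym (res-+ m (n ∸ m))) (trans (cong res (m+[n∸m]≡n m≤n)) (sym res≡))
... | k , d≡ = k , trans (sym (m+[n∸m]≡n m≤n)) (cong (m +_) d≡)

res≡∧<⇒+3≤ : ∀ {m n} → res m ≡ res n → m < n → m + 3 ≤ n
res≡∧<⇒+3≤ {m} m≡ m<n with res≡⇒+*3 m≡ (<⇒≤ m<n)
... | zero  , refl = ⊥-elim (<-irrefl (sym (+-identityʳ m)) m<n)
... | suc k , refl = +-monoʳ-≤ m (m≤m+n 3 (k * 3))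

apery : ℕ → ℕ → ℤ₃ → ℕ
apery a b 0₃ = 0
apery a b 1₃ = a
apery a b 2₃ = b

⟨3,_,_⟩ : ℕ → ℕ → Subset
⟨3, a , b ⟩ n = apery a b (res n) ≤ᵇ n

module _ {a b : ℕ} where

  ∈⟨3⟩⁺ : ∀ {n ρ} → res n ≡ ρ → apery a b ρ ≤ n → n ∈S ⟨3, a , b ⟩
  ∈⟨3⟩⁺ refl le = Equivalence.to T-≡ (≤⇒≤ᵇ le)

  ∈⟨3⟩⁻ : ∀ {n ρ} → res n ≡ ρ → n ∈S ⟨3, a , b ⟩ → apery a b ρ ≤ n
  ∈⟨3⟩⁻ {n} refl n∈ = ≤ᵇ⇒≤ _ n (Equivalence.from T-≡ n∈)

  ∉⟨3⟩ : ∀ {n ρ} → res n ≡ ρ → n < apery a b ρ → ⟨3, a , b ⟩ n ≡ false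
  ∉⟨3⟩ res≡ n<ap = ¬-not λ n∈ → <⇒≱ n<ap (∈⟨3⟩⁻ res≡ n∈)

  module WithResidues (res-a : res a ≡ 1₃) (res-b : res b ≡ 2₃) where

    res-apery : ∀ ρ → res (apery a b ρ) ≡ ρ
    res-apery 0₃ = refl
    res-apery 1₃ = res-a
    res-apery 2₃ = res-b

    apery-∈⟨3⟩ : ∀ ρ → apery a b ρ ∈S ⟨3, a , b ⟩
    apery-∈⟨3⟩ ρ = ∈⟨3⟩⁺ (res-apery ρ) ≤-refl

    ∈⟨3⟩⇒apery+*3 : ∀ {n} → n ∈S ⟨3, a , b ⟩ → ∃ λ k → n ≡ apery a b (res n) + k * 3
    ∈⟨3⟩⇒apery+*3 {n} n∈ = res≡⇒+*3 (res-apery _) (∈⟨3⟩⁻ {n} refl n∈)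

  apery-subadditive : b ≤ a + a → a ≤ b + b →
    ∀ ρ σ → apery a b (ρ +₃ σ) ≤ apery a b ρ + apery a b σ
  apery-subadditive _    _    0₃ σ  = ≤-refl
  apery-subadditive _    _    1₃ 0₃ = m≤m+n a 0
  apery-subadditive _    _    2₃ 0₃ = m≤m+n b 0
  apery-subadditive b≤2a _    1₃ 1₃ = b≤2a
  apery-subadditive _    _    1₃ 2₃ = z≤n
  apery-subadditive _    _    2₃ 1₃ = z≤n
  apery-subadditive _    a≤2b 2₃ 2₃ = a≤2b

  ⟨3⟩-isNumericalSemigroup : b ≤ a + a → a ≤ b + b → IsNumericalSemigroup ⟨3, a , b ⟩
  ⟨3⟩-isNumericalSemigroup b≤2a a≤2b = record
    { zero∈    = refl
    ; closed   = closed
    ; cofinite = a + b , λ n a+b≤n → ∈⟨3⟩⁺ refl (≤-trans (apery≤a+b (res n)) a+b≤n)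
    }
    where
    open ≤-Reasoning
    closed : ∀ m n → m ∈S ⟨3, a , b ⟩ → n ∈S ⟨3, a , b ⟩ → (m + n) ∈S ⟨3, a , b ⟩
    closed m n m∈ n∈ = ∈⟨3⟩⁺ (res-+ m n) (begin
      apery a b (res m +₃ res n)            ≤⟨ apery-subadditive b≤2a a≤2b (res m) (res n) ⟩
      apery a b (res m) + apery a b (res n)  ≤⟨ +-mono-≤ (∈⟨3⟩⁻ {m} refl m∈) (∈⟨3⟩⁻ {n} refl n∈) ⟩
      m + n                                  ∎)
    apery≤a+b : ∀ ρ → apery a b ρ ≤ a + b
    apery≤a+b 0₃ = z≤n
    apery≤a+b 1₃ = m≤m+n a b
    apery≤a+b 2₃ = m≤n+m b a

  ⟨3⟩-multiplicity : 3 < a → 3 < b → Multiplicity ⟨3, a , b ⟩ 3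
  ⟨3⟩-multiplicity 3<a 3<b = s≤s z≤n , refl , below3
    where
    below3 : ∀ k → 0 < k → k < 3 → ⟨3, a , b ⟩ k ≡ false
    below3 1 _ _ = ∉⟨3⟩ refl (<-trans (s≤s (s≤s z≤n)) 3<a)
    below3 2 _ _ = ∉⟨3⟩ refl (<-trans (s≤s (s≤s (s≤s z≤n))) 3<b)
    below3 (suc (suc (suc _))) _ (s≤s (s≤s (s≤s ())))

module _ {A : ℕ → Set} where

  Gen-ind : (P : ℕ → Set) → P 0 → (∀ {m n} → P m → P n → P (m + n)) →
            (∀ {x} → A x → P x) → ∀ {n} → Gen A n → P n
  Gen-ind P P0 P+ A⊆P gzero      = P0
  Gen-ind P P0 P+ A⊆P (gadd x g) = P+ (A⊆P x) (Gen-ind P P0 P+ A⊆P g)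

  Gen-+ : ∀ {m n} → Gen A m → Gen A n → Gen A (m + n)
  Gen-+           gzero                  h = h
  Gen-+ {n = n} (gadd {x} {m} Ax g) h = subst (Gen A) (sym (+-assoc x m n)) (gadd Ax (Gen-+ g h))

  Gen-single : ∀ {x} → A x → Gen A x
  Gen-single {x} Ax = subst (Gen A) (+-identityʳ x) (gadd Ax gzero)

  Gen-*3 : A 3 → ∀ k → Gen A (k * 3)
  Gen-*3 A3 zero    = gzero
  Gen-*3 A3 (suc k) = gadd A3 (Gen-*3 A3 k)

  Gen-⊆ : ∀ {S} → IsNumericalSemigroup S → (∀ {x} → A x → x ∈S S) → ∀ {n} → Gen A n → n ∈S S
  Gen-⊆ {S} ns = Gen-ind (_∈S S) zero∈ (λ {m} {n} → closed m n) where open IsNumericalSemigroup ns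

  ¬Generates-⊆ : ∀ {S x} (P : ℕ → Set) → P 0 → (∀ {m n} → P m → P n → P (m + n)) →
                 (∀ {y} → A y → P y) → x ∈S S → ¬ P x → ¬ Generates S A
  ¬Generates-⊆ P P0 P+ A⊆P x∈S ¬Px gen = ¬Px (Gen-ind P P0 P+ A⊆P (proj₁ (gen _) x∈S))

Gen-mono : ∀ {A B : ℕ → Set} → (∀ {x} → A x → Gen B x) → ∀ {n} → Gen A n → Gen B n
Gen-mono {B = B} = Gen-ind (Gen B) gzero Gen-+

module _ {a b : ℕ} (res-a : res a ≡ 1₃) (res-b : res b ≡ 2₃) where

  open WithResidues {a} {b} res-a res-b

  ⟨3⟩⊆Gen : ∀ {A} → A 3 → (∀ ρ → Gen A (apery a b ρ)) → ∀ {n} → n ∈S ⟨3, a , b ⟩ → Gen A n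
  ⟨3⟩⊆Gen A3 Gen-apery {n} n∈ with ∈⟨3⟩⇒apery+*3 n∈
  ... | k , n≡ = subst (Gen _) (sym n≡) (Gen-+ (Gen-apery (res n)) (Gen-*3 A3 k))

  ⟨3⟩-generates : b ≤ a + a → a ≤ b + b → Generates ⟨3, a , b ⟩ (_∈ 3 ∷ a ∷ b ∷ [])
  ⟨3⟩-generates b≤2a a≤2b n = ⟨3⟩⊆Gen (here refl) Gen-apery , Gen-⊆ ns gens∈
    where
    ns = ⟨3⟩-isNumericalSemigroup b≤2a a≤2b
    Gen-apery : ∀ ρ → Gen (_∈ 3 ∷ a ∷ b ∷ []) (apery a b ρ)
    Gen-apery 0₃ = gzero
    Gen-apery 1₃ = Gen-single (there (here refl))
    Gen-apery 2₃ = Gen-single (there (there (here refl)))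
    gens∈ : ∀ {x} → x ∈ 3 ∷ a ∷ b ∷ [] → x ∈S ⟨3, a , b ⟩
    gens∈ (here refl)                 = refl
    gens∈ (there (here refl))         = apery-∈⟨3⟩ 1₃
    gens∈ (there (there (here refl))) = apery-∈⟨3⟩ 2₃

  ⟨3⟩-embeddingDimension : 3 < a → 3 < b → a < b + b → b < a + a → EmbeddingDimension ⟨3, a , b ⟩ 3
  ⟨3⟩-embeddingDimension 3<a 3<b a<2b b<2a =
    gens , (distinct , ⟨3⟩-generates (<⇒≤ b<2a) (<⇒≤ a<2b) , minimal) , refl
    where
    gens : List ℕ
    gens = 3 ∷ a ∷ b ∷ []
    a≢b : a ≢ b
    a≢b a≡b with () ← trans (sym res-a) (trans (cong res a≡b) res-b)
    distinct = (<⇒≢ 3<a ∷ <⇒≢ 3<b ∷ []) ∷ (a≢b ∷ []) ∷ [] ∷ []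
    Above3 : ℕ → Set
    Above3 n = n ≡ 0 ⊎ 3 < n
    Above3-+ : ∀ {m n} → Above3 m → Above3 n → Above3 (m + n)
    Above3-+ (inj₁ refl) q = q
    Above3-+ {m} {n} (inj₂ 3<m) _ = inj₂ (≤-trans 3<m (m≤m+n m n))
    -- Without 3 every generated element is 0 or above 3; without a (resp. b) all generators lie
    -- in the numerical semigroup ⟨3, b + b , b⟩ (resp. ⟨3, a , a + a⟩), which misses a (resp. b).
    minimal : ∀ x → x ∈ gens → ¬ Generates ⟨3, a , b ⟩ (λ n → n ∈ gens × n ≢ x)
    minimal .3 (here refl) = ¬Generates-⊆ {x = 3} Above3 (inj₁ refl) Above3-+ ⊆Above3 refl
      λ { (inj₁ ()) ; (inj₂ (s≤s (s≤s (s≤s ())))) }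
      where
      ⊆Above3 : ∀ {y} → y ∈ gens × y ≢ 3 → Above3 y
      ⊆Above3 (here refl , y≢3)                 = ⊥-elim (y≢3 refl)
      ⊆Above3 (there (here refl) , _)           = inj₂ 3<a
      ⊆Above3 (there (there (here refl)) , _)   = inj₂ 3<b
    minimal .a (there (here refl)) =
      ¬Generates-⊆ {x = a} (_∈S ⟨3, b + b , b ⟩) refl (λ {m} {n} → closed m n) ⊆S′
        (apery-∈⟨3⟩ 1₃) (λ a∈ → <⇒≱ a<2b (∈⟨3⟩⁻ {n = a} res-a a∈))
      where
      open IsNumericalSemigroup
        (⟨3⟩-isNumericalSemigroup {b + b} {b} (≤-trans (m≤m+n b b) (m≤m+n (b + b) (b + b))) ≤-refl)
      ⊆S′ : ∀ {y} → y ∈ gens × y ≢ a → y ∈S ⟨3, b + b , b ⟩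
      ⊆S′ (here refl , _)                   = refl
      ⊆S′ (there (here refl) , y≢a)         = ⊥-elim (y≢a refl)
      ⊆S′ (there (there (here refl)) , _)   = ∈⟨3⟩⁺ {n = b} res-b ≤-refl
    minimal .b (there (there (here refl))) =
      ¬Generates-⊆ {x = b} (_∈S ⟨3, a , a + a ⟩) refl (λ {m} {n} → closed m n) ⊆S′
        (apery-∈⟨3⟩ 2₃) (λ b∈ → <⇒≱ b<2a (∈⟨3⟩⁻ {n = b} res-b b∈))
      where
      open IsNumericalSemigroup
        (⟨3⟩-isNumericalSemigroup {a} {a + a} ≤-refl (≤-trans (m≤m+n a a) (m≤m+n (a + a) (a + a))))
      ⊆S′ : ∀ {y} → y ∈ gens × y ≢ b → y ∈S ⟨3, a , a + a ⟩
      ⊆S′ (here refl , _)                   = refl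
      ⊆S′ (there (here refl) , _)           = ∈⟨3⟩⁺ {n = a} res-a ≤-refl
      ⊆S′ (there (there (here refl)) , y≢b) = ⊥-elim (y≢b refl)

IsAtom : Subset → ℕ → Set
IsAtom S x = 0 < x × ∀ y z → y + z ≡ x → y ∈S S → z ∈S S → y ≡ 0 ⊎ z ≡ 0

atom∈generators : ∀ {S A x} → Generates S A → IsAtom S x → x ∈S S → A x
atom∈generators {S} {A} {x} gen (0<x , atomic) x∈S = go (proj₁ (gen x) x∈S) refl
  where
  go : ∀ {n} → Gen A n → n ≡ x → A x
  go gzero 0≡x = ⊥-elim (<-irrefl 0≡x 0<x)
  go (gadd {y} {n} Ay g) y+n≡x with atomic y n y+n≡x (proj₂ (gen y) (Gen-single Ay)) (proj₂ (gen n) g)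
  ... | inj₁ refl = go g y+n≡x
  ... | inj₂ refl = subst A (trans (sym (+-identityʳ y)) y+n≡x) Ay

multiplicity-atom : ∀ {S m} → Multiplicity S m → IsAtom S m
multiplicity-atom {S} {m} (0<m , _ , below) = 0<m , split
  where
  split : ∀ y z → y + z ≡ m → y ∈S S → z ∈S S → y ≡ 0 ⊎ z ≡ 0
  split zero    _       _     _  _ = inj₁ refl
  split (suc y) zero    _     _  _ = inj₂ refl
  split (suc y) (suc z) y+z≡m y∈ _ = ⊥-elim (not-¬ y∈ (below (suc y) (s≤s z≤n) y<m))
    where y<m = subst (suc y <_) y+z≡m (m<m+n (suc y) (s≤s z≤n))

-- Both summands would lie below w, hence be multiples of 3, and then so would w.
lowestOutside3ℕ-atom : ∀ {S w} → res w ≢ 0₃ → (∀ n → n ∈S S → n < w → res n ≡ 0₃) → IsAtom S w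
lowestOutside3ℕ-atom {S} {w} res-w≢0 below = 0<w , split
  where
  0<w : 0 < w
  0<w = ≤∧≢⇒< z≤n λ { refl → res-w≢0 refl }
  split : ∀ y z → y + z ≡ w → y ∈S S → z ∈S S → y ≡ 0 ⊎ z ≡ 0
  split zero    _       _     _  _  = inj₁ refl
  split (suc y) zero    _     _  _  = inj₂ refl
  split (suc y) (suc z) y+z≡w y∈ z∈ = ⊥-elim (res-w≢0 (begin
    res w                          ≡⟨ cong res (sym y+z≡w) ⟩
    res (suc y + suc z)            ≡⟨ res-+ (suc y) (suc z) ⟩
    res (suc y) +₃ res (suc z)     ≡⟨ cong₂ _+₃_ (below _ y∈ y<w) (below _ z∈ z<w) ⟩
    0₃                             ∎))
    where
    open ≡-Reasoning
    y<w = subst (suc y <_) y+z≡w (m<m+n (suc y) (s≤s z≤n))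
    z<w = subst (suc z <_) y+z≡w (m<n+m (suc z) (s≤s z≤n))

∃-∉-pair : ∀ p q {g₁ g₂ g₃ : ℕ} → AllPairs _≢_ (g₁ ∷ g₂ ∷ g₃ ∷ []) →
           ∃ λ x → x ∈ g₁ ∷ g₂ ∷ g₃ ∷ [] × x ≢ p × x ≢ q
∃-∉-pair p q {g₁} {g₂} {g₃} ((g₁≢g₂ ∷ g₁≢g₃ ∷ []) ∷ (g₂≢g₃ ∷ []) ∷ _)
  with g₁ ≟ p | g₁ ≟ q | g₂ ≟ p | g₂ ≟ q
... | no g₁≢p  | no g₁≢q  | _        | _        = g₁ , here refl , g₁≢p , g₁≢q
... | _        | _        | no g₂≢p  | no g₂≢q  = g₂ , there (here refl) , g₂≢p , g₂≢q
... | yes refl | _        | _        | yes refl = g₃ , there (there (here refl)) , g₁≢g₃ ∘ sym , g₂≢g₃ ∘ sym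
... | _        | yes refl | yes refl | _        = g₃ , there (there (here refl)) , g₂≢g₃ ∘ sym , g₁≢g₃ ∘ sym
... | yes refl | _        | yes refl | _        = ⊥-elim (g₁≢g₂ refl)
... | _        | yes refl | _        | yes refl = ⊥-elim (g₁≢g₂ refl)

-- A minimal system of generators contains every atom, so a third generator would be redundant.
twoAtoms⇒¬embeddingDimension3 : ∀ {S p q} → Generates S (λ n → n ≡ p ⊎ n ≡ q) →
  IsAtom S p → p ∈S S → IsAtom S q → q ∈S S → ¬ EmbeddingDimension S 3
twoAtoms⇒¬embeddingDimension3 {S} {p} {q} genpq atom-p p∈ atom-q q∈
  (g₁ ∷ g₂ ∷ g₃ ∷ [] , (distinct , gen , minimal) , refl) with ∃-∉-pair p q distinct
... | x , x∈ , x≢p , x≢q = minimal x x∈ gen′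
  where
  p∈gs = atom∈generators gen atom-p p∈
  q∈gs = atom∈generators gen atom-q q∈
  pq⊆gs∖x : ∀ {n} → n ≡ p ⊎ n ≡ q → Gen (λ n → n ∈ g₁ ∷ g₂ ∷ g₃ ∷ [] × n ≢ x) n
  pq⊆gs∖x (inj₁ refl) = Gen-single (p∈gs , x≢p ∘ sym)
  pq⊆gs∖x (inj₂ refl) = Gen-single (q∈gs , x≢q ∘ sym)
  gen′ : Generates S (λ n → n ∈ g₁ ∷ g₂ ∷ g₃ ∷ [] × n ≢ x)
  gen′ n = (λ n∈ → Gen-mono pq⊆gs∖x (proj₁ (genpq n) n∈))
         , (λ g → proj₂ (gen n) (Gen-mono (Gen-single ∘ proj₁) g))
twoAtoms⇒¬embeddingDimension3 _ _ _ _ _ (_ ∷ _ ∷ _ ∷ _ ∷ _ , _ , ())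
twoAtoms⇒¬embeddingDimension3 _ _ _ _ _ (_ ∷ _ ∷ [] , _ , ())
twoAtoms⇒¬embeddingDimension3 _ _ _ _ _ (_ ∷ [] , _ , ())
twoAtoms⇒¬embeddingDimension3 _ _ _ _ _ ([] , _ , ())

classes : ∀ {ρ} → ρ ≢ 0₃ → ∀ σ → σ ≡ 0₃ ⊎ σ ≡ ρ ⊎ σ ≡ ρ +₃ ρ
classes {0₃} ρ≢0 _  = ⊥-elim (ρ≢0 refl)
classes {1₃} _   0₃ = inj₁ refl
classes {1₃} _   1₃ = inj₂ (inj₁ refl)
classes {1₃} _   2₃ = inj₂ (inj₂ refl)
classes {2₃} _   0₃ = inj₁ refl
classes {2₃} _   1₃ = inj₂ (inj₂ refl)
classes {2₃} _   2₃ = inj₂ (inj₁ refl)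

module _ {a b : ℕ} (res-a : res a ≡ 1₃) (res-b : res b ≡ 2₃) where

  open WithResidues {a} {b} res-a res-b

  ⟨3⟩-isNumericalSemigroup⁻ : IsNumericalSemigroup ⟨3, a , b ⟩ → b ≤ a + a × a ≤ b + b
  ⟨3⟩-isNumericalSemigroup⁻ ns =
      ∈⟨3⟩⁻ {n = a + a} (trans (res-+ a a) (cong₂ _+₃_ res-a res-a)) (closed a a a∈ a∈)
    , ∈⟨3⟩⁻ {n = b + b} (trans (res-+ b b) (cong₂ _+₃_ res-b res-b)) (closed b b b∈ b∈)
    where
    open IsNumericalSemigroup ns
    a∈ = apery-∈⟨3⟩ 1₃
    b∈ = apery-∈⟨3⟩ 2₃

  module _ (ns : IsNumericalSemigroup ⟨3, a , b ⟩) (mult : Multiplicity ⟨3, a , b ⟩ 3) where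

    -- S is then generated by its two atoms 3 and apery ρ.
    ⟨3⟩-doubled⇒¬embeddingDimension3 : ∀ ρ → ρ ≢ 0₃ →
      apery a b (ρ +₃ ρ) ≡ apery a b ρ + apery a b ρ → ¬ EmbeddingDimension ⟨3, a , b ⟩ 3
    ⟨3⟩-doubled⇒¬embeddingDimension3 ρ ρ≢0 doubled =
      twoAtoms⇒¬embeddingDimension3 gen (multiplicity-atom mult) refl atom-y (apery-∈⟨3⟩ ρ)
      where
      y = apery a b ρ
      GenApery : ∀ σ → Gen (λ n → n ≡ 3 ⊎ n ≡ y) (apery a b σ)
      GenApery σ with classes ρ≢0 σ
      ... | inj₁ refl        = gzero
      ... | inj₂ (inj₁ refl) = Gen-single (inj₂ refl)
      ... | inj₂ (inj₂ refl) =
        subst (Gen _) (sym doubled) (Gen-+ (Gen-single (inj₂ refl)) (Gen-single (inj₂ refl)))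
      3y⊆S : ∀ {n} → n ≡ 3 ⊎ n ≡ y → n ∈S ⟨3, a , b ⟩
      3y⊆S (inj₁ refl) = refl
      3y⊆S (inj₂ refl) = apery-∈⟨3⟩ ρ
      gen : Generates ⟨3, a , b ⟩ (λ n → n ≡ 3 ⊎ n ≡ y)
      gen n = ⟨3⟩⊆Gen res-a res-b (inj₁ refl) GenApery , Gen-⊆ ns 3y⊆S
      below-y : ∀ n → n ∈S ⟨3, a , b ⟩ → n < y → res n ≡ 0₃
      below-y n n∈ n<y with classes ρ≢0 (res n)
      ... | inj₁ res≡0 = res≡0
      ... | inj₂ (inj₁ res≡ρ) = ⊥-elim (<⇒≱ n<y (∈⟨3⟩⁻ res≡ρ n∈))
      ... | inj₂ (inj₂ res≡2ρ) =
        ⊥-elim (<⇒≱ (<-≤-trans n<y (≤-trans (m≤m+n y y) (≤-reflexive (sym doubled)))) (∈⟨3⟩⁻ res≡2ρ n∈))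
      atom-y : IsAtom ⟨3, a , b ⟩ y
      atom-y = lowestOutside3ℕ-atom (λ res-y≡0 → ρ≢0 (trans (sym (res-apery ρ)) res-y≡0)) below-y

    ⟨3⟩-embeddingDimension⁻ : EmbeddingDimension ⟨3, a , b ⟩ 3 → a < b + b × b < a + a
    ⟨3⟩-embeddingDimension⁻ ed =
        ≤∧≢⇒< a≤2b (λ a≡2b → ⟨3⟩-doubled⇒¬embeddingDimension3 2₃ (λ ()) a≡2b ed)
      , ≤∧≢⇒< b≤2a (λ b≡2a → ⟨3⟩-doubled⇒¬embeddingDimension3 1₃ (λ ()) b≡2a ed)
      where
      b≤2a = proj₁ (⟨3⟩-isNumericalSemigroup⁻ ns)
      a≤2b = proj₂ (⟨3⟩-isNumericalSemigroup⁻ ns)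

  ⟨3⟩-frobenius⇔ : ∀ {F} → FrobeniusNumber ⟨3, a , b ⟩ F ⇔
                   (apery a b (res F) ≡ F + 3 × ∀ ρ → apery a b ρ ≤ F + 3)
  ⟨3⟩-frobenius⇔ {F} = mk⇔ from-frob to-frob
    where
    from-frob : FrobeniusNumber ⟨3, a , b ⟩ F → apery a b (res F) ≡ F + 3 × ∀ ρ → apery a b ρ ≤ F + 3
    from-frob (F∉ , above) =
      ≤-antisym (bound (res F)) (res≡∧<⇒+3≤ (sym (res-apery (res F))) F<apery) , bound
      where
      F<apery : F < apery a b (res F)
      F<apery = ≰⇒> λ apery≤F → not-¬ (∈⟨3⟩⁺ {n = F} refl apery≤F) F∉
      -- Otherwise apery ρ ∸ 3 would be an element of S above F lying below apery ρ in its class.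
      bound : ∀ ρ → apery a b ρ ≤ F + 3
      bound ρ with apery a b ρ ≤? F + 3
      ... | yes ap≤ = ap≤
      ... | no  ap≰ = ⊥-elim (<⇒≱ x<ap (∈⟨3⟩⁻ res-x (above x F<x)))
        where
        ap = apery a b ρ
        x = ap ∸ 3
        x+3≡ap : x + 3 ≡ ap
        x+3≡ap = m∸n+n≡m (≤-trans (m≤n+m 3 F) (<⇒≤ (≰⇒> ap≰)))
        F<x : F < x
        F<x = +-cancelʳ-< 3 F x (subst (F + 3 <_) (sym x+3≡ap) (≰⇒> ap≰))
        res-x : res x ≡ ρ
        res-x = trans (sym (res-+*3 x 1)) (trans (cong res x+3≡ap) (res-apery ρ))
        x<ap : x < ap
        x<ap = subst (x <_) x+3≡ap (m<m+n x (s≤s z≤n))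
    to-frob : apery a b (res F) ≡ F + 3 × (∀ ρ → apery a b ρ ≤ F + 3) → FrobeniusNumber ⟨3, a , b ⟩ F
    to-frob (frob , bound) = ∉⟨3⟩ refl (subst (F <_) (sym frob) (m<m+n F (s≤s z≤n))) , above
      where
      above : ∀ n → F < n → n ∈S ⟨3, a , b ⟩
      above n F<n with apery a b (res n) ≤? n
      ... | yes ap≤n = ∈⟨3⟩⁺ refl ap≤n
      ... | no  ap≰n = ⊥-elim (<⇒≱ F<n (+-cancelʳ-≤ 3 n F (≤-trans n+3≤ap (bound (res n)))))
        where n+3≤ap = res≡∧<⇒+3≤ (sym (res-apery (res n))) (≰⇒> ap≰n)

Least : (ℕ → Set) → Set
Least P = ∃ λ m → P m × ∀ k → P k → m ≤ k

least : ∀ {P : ℕ → Set} → Decidable P → ∀ {n} → P n → Least P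
least {P} P? {n} = <-rec (λ n → P n → Least P) step n
  where
  step : ∀ n → (∀ {m} → m < n → P m → Least P) → P n → Least P
  step n rec Pn with anyUpTo? P? n
  ... | yes (m , m<n , Pm) = rec m<n Pm
  ... | no  ¬smaller       = n , Pn , λ k Pk → ≮⇒≥ λ k<n → ¬smaller (k , k<n , Pk)

module _ {S : Subset} (ns : IsNumericalSemigroup S) (3∈S : 3 ∈S S) where

  open IsNumericalSemigroup ns

  *3∈ : ∀ k → (k * 3) ∈S S
  *3∈ = Gen-⊆ {_≡ 3} ns (λ { refl → 3∈S }) ∘ Gen-*3 refl

  leastInClass : ∀ ρ → ∃ λ w → res w ≡ ρ × w ∈S S × ∀ n → res n ≡ ρ → n ∈S S → w ≤ n
  leastInClass ρ =
    let (k , w∈ , minimal) = least (λ k → S (rep ρ + k * 3) Bool.≟ true) {N} (proj₂ cofinite _ N≤rep+N*3)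
    in rep ρ + k * 3 , trans (res-+*3 (rep ρ) k) (res-rep ρ) , w∈ , λ n res-n n∈ →
       let (j , n≡) = res≡⇒rep+*3 res-n
       in subst (rep ρ + k * 3 ≤_) (sym n≡)
            (+-monoʳ-≤ (rep ρ) (*-monoˡ-≤ 3 (minimal j (subst (_∈S S) n≡ n∈))))
    where
    N = proj₁ cofinite
    N≤rep+N*3 : N ≤ rep ρ + N * 3
    N≤rep+N*3 = ≤-trans (m≤m*n N 3) (m≤n+m (N * 3) (rep ρ))

  ≈⟨3⟩ : ∃₂ λ a b → res a ≡ 1₃ × res b ≡ 2₃ × S ≈S ⟨3, a , b ⟩
  ≈⟨3⟩ = a , b , res-a , res-b , λ n → ⇔→≡ {z = true} (mk⇔ (∈⟨3⟩⁺ refl ∘ apery≤ n) (⟨3⟩⊆S n))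
    where
    a = proj₁ (leastInClass 1₃)
    b = proj₁ (leastInClass 2₃)
    res-a = proj₁ (proj₂ (leastInClass 1₃))
    res-b = proj₁ (proj₂ (leastInClass 2₃))
    open WithResidues {a} {b} res-a res-b
    apery∈S : ∀ ρ → apery a b ρ ∈S S
    apery∈S 0₃ = zero∈
    apery∈S 1₃ = proj₁ (proj₂ (proj₂ (leastInClass 1₃)))
    apery∈S 2₃ = proj₁ (proj₂ (proj₂ (leastInClass 2₃)))
    apery≤ : ∀ n → n ∈S S → apery a b (res n) ≤ n
    apery≤ n n∈ with res n in res-n
    ... | 0₃ = z≤n
    ... | 1₃ = proj₂ (proj₂ (proj₂ (leastInClass 1₃))) n res-n n∈
    ... | 2₃ = proj₂ (proj₂ (proj₂ (leastInClass 2₃))) n res-n n∈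
    ⟨3⟩⊆S : ∀ n → n ∈S ⟨3, a , b ⟩ → n ∈S S
    ⟨3⟩⊆S n n∈ with ∈⟨3⟩⇒apery+*3 n∈
    ... | k , n≡ = subst (_∈S S) (sym n≡) (closed _ (k * 3) (apery∈S (res n)) (*3∈ k))

module _ {S T : Subset} (S≈T : S ≈S T) where

  ∈-resp-≈ : ∀ {n c} → S n ≡ c → T n ≡ c
  ∈-resp-≈ {n} = trans (sym (S≈T n))

  ∈-resp-≈⁻ : ∀ {n c} → T n ≡ c → S n ≡ c
  ∈-resp-≈⁻ {n} = trans (S≈T n)

  isNumericalSemigroup-resp-≈ : IsNumericalSemigroup S → IsNumericalSemigroup T
  isNumericalSemigroup-resp-≈ ns = record
    { zero∈    = ∈-resp-≈ zero∈
    ; closed   = λ m n m∈ n∈ → ∈-resp-≈ (closed m n (∈-resp-≈⁻ m∈) (∈-resp-≈⁻ n∈))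
    ; cofinite = proj₁ cofinite , λ n N≤n → ∈-resp-≈ (proj₂ cofinite n N≤n)
    }
    where open IsNumericalSemigroup ns

  generates-resp-≈ : ∀ {A} → Generates S A → Generates T A
  generates-resp-≈ gen n = proj₁ (gen n) ∘ ∈-resp-≈⁻ , ∈-resp-≈ ∘ proj₂ (gen n)

  multiplicity-resp-≈ : ∀ {m} → Multiplicity S m → Multiplicity T m
  multiplicity-resp-≈ (0<m , m∈ , below) =
    0<m , ∈-resp-≈ m∈ , λ k 0<k k<m → ∈-resp-≈ (below k 0<k k<m)

  frobeniusNumber-resp-≈ : ∀ {F} → FrobeniusNumber S F → FrobeniusNumber T F
  frobeniusNumber-resp-≈ (F∉ , above) = ∈-resp-≈ F∉ , λ n F<n → ∈-resp-≈ (above n F<n)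

≈S-sym : ∀ {S T} → S ≈S T → T ≈S S
≈S-sym S≈T n = sym (S≈T n)

embeddingDimension-resp-≈ : ∀ {S T e} → S ≈S T → EmbeddingDimension S e → EmbeddingDimension T e
embeddingDimension-resp-≈ S≈T (gs , (distinct , gen , minimal) , length≡) =
  gs , (distinct , generates-resp-≈ S≈T gen , λ x x∈ → minimal x x∈ ∘ generates-resp-≈ (≈S-sym S≈T))
     , length≡

isMED3Frob-resp-≈ : ∀ {S T F} → S ≈S T → IsMED3Frob F S → IsMED3Frob F T
isMED3Frob-resp-≈ S≈T (ns , (m , mult-m , ed-m) , mult3 , frob) =
    isNumericalSemigroup-resp-≈ S≈T ns
  , (m , multiplicity-resp-≈ S≈T mult-m , embeddingDimension-resp-≈ S≈T ed-m)
  , multiplicity-resp-≈ S≈T mult3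
  , frobeniusNumber-resp-≈ S≈T frob

multiplicity-unique : ∀ {S m n} → Multiplicity S m → Multiplicity S n → m ≡ n
multiplicity-unique {m = m} {n} (0<m , m∈ , below-m) (0<n , n∈ , below-n) with <-cmp m n
... | tri< m<n _ _ = ⊥-elim (not-¬ m∈ (below-n m 0<m m<n))
... | tri≈ _ m≡n _ = m≡n
... | tri> _ _ n<m = ⊥-elim (not-¬ n∈ (below-m n 0<n n<m))

record IsMED3FrobApery (F a b : ℕ) : Set where
  field
    res-a       : res a ≡ 1₃
    res-b       : res b ≡ 2₃
    a<b+b       : a < b + b
    b<a+a       : b < a + a
    apery-frob  : apery a b (res F) ≡ F + 3
    apery-bound : ∀ ρ → apery a b ρ ≤ F + 3

apery-3< : ∀ a b → res a ≡ 1₃ → res b ≡ 2₃ → a < b + b → b < a + a → 3 < a × 3 < b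
apery-3< a b res-a res-b a<2b b<2a = 3<a a b res-a res-b b<2a , 3<b a b res-a res-b a<2b b<2a
  where
  4≤4+ : ∀ {n} → 3 < 4 + n
  4≤4+ = s≤s (s≤s (s≤s (s≤s z≤n)))
  3<a : ∀ a b → res a ≡ 1₃ → res b ≡ 2₃ → b < a + a → 3 < a
  3<a 1 (suc (suc b)) _ _ (s≤s (s≤s ()))
  3<a (suc (suc (suc (suc a)))) _ _ _ _ = 4≤4+
  3<b : ∀ a b → res a ≡ 1₃ → res b ≡ 2₃ → a < b + b → b < a + a → 3 < b
  3<b 1 2 _ _ _ (s≤s (s≤s ()))
  3<b (suc (suc (suc (suc a)))) 2 _ _ (s≤s (s≤s (s≤s (s≤s ())))) _
  3<b _ (suc (suc (suc (suc b)))) _ _ _ _ = 4≤4+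

isMED3FrobApery⇒isMED3Frob : ∀ {F a b} → IsMED3FrobApery F a b → IsMED3Frob F ⟨3, a , b ⟩
isMED3FrobApery⇒isMED3Frob {F} {a} {b} A =
    ⟨3⟩-isNumericalSemigroup (<⇒≤ b<a+a) (<⇒≤ a<b+b)
  , (3 , mult , ⟨3⟩-embeddingDimension res-a res-b 3<a 3<b a<b+b b<a+a)
  , mult
  , Equivalence.from (⟨3⟩-frobenius⇔ res-a res-b) (apery-frob , apery-bound)
  where
  open IsMED3FrobApery A
  3<a = proj₁ (apery-3< a b res-a res-b a<b+b b<a+a)
  3<b = proj₂ (apery-3< a b res-a res-b a<b+b b<a+a)
  mult = ⟨3⟩-multiplicity 3<a 3<b

isMED3Frob⇒≈⟨3⟩ : ∀ {F S} → IsMED3Frob F S → ∃₂ λ a b → IsMED3FrobApery F a b × S ≈S ⟨3, a , b ⟩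
isMED3Frob⇒≈⟨3⟩ {F} {S} M@(ns , _ , mult3 , _) =
  let (a , b , res-a , res-b , S≈) = ≈⟨3⟩ ns (proj₁ (proj₂ mult3))
      (ns′ , (m , mult-m , ed-m) , mult3′ , frob′) = isMED3Frob-resp-≈ S≈ M
      ed3 = subst (EmbeddingDimension ⟨3, a , b ⟩) (multiplicity-unique mult-m mult3′) ed-m
      (a<b+b , b<a+a) = ⟨3⟩-embeddingDimension⁻ res-a res-b ns′ mult3′ ed3
      (apery-frob , apery-bound) = Equivalence.to (⟨3⟩-frobenius⇔ res-a res-b) frob′
  in a , b , record { res-a = res-a ; res-b = res-b ; a<b+b = a<b+b ; b<a+a = b<a+a
                    ; apery-frob = apery-frob ; apery-bound = apery-bound } , S≈

numberOf-enumeration : ∀ {P : Subset → Set} (f : ℕ → Subset) n →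
  (∀ {i j} → f i ≈S f j → i ≡ j) → (∀ {i} → i < n → P (f i)) →
  (∀ S → P S → ∃ λ i → i < n × S ≈S f i) → NumberOf P n
numberOf-enumeration f n f-injective P-f complete =
    applyUpTo f n
  , length-applyUpTo f n
  , All.applyUpTo⁺₁ f n P-f
  , AllPairs.applyUpTo⁺₁ f n (λ i<j _ fi≈fj → <⇒≢ i<j (f-injective fi≈fj))
  , λ S PS → let (i , i<n , S≈) = complete S PS in Any.applyUpTo⁺ f S≈ i<n

m<j+j⇔m/2<j : ∀ {m j} → m < j + j ⇔ m / 2 < j
m<j+j⇔m/2<j {m} {j} = mk⇔ (λ m<2j → m<n*o⇒m/o<n (subst (m <_) (j+j≡j*2 j) m<2j)) from
  where
  j+j≡j*2 : ∀ j → j + j ≡ j * 2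
  j+j≡j*2 = solve-∀
  from : m / 2 < j → m < j + j
  from m/2<j = begin-strict
    m                   ≡⟨ m≡m%n+[m/n]*n m 2 ⟩
    m % 2 + m / 2 * 2   <⟨ +-monoˡ-< (m / 2 * 2) (m%n<n m 2) ⟩
    suc (m / 2) * 2     ≤⟨ *-monoˡ-≤ 2 m/2<j ⟩
    j * 2               ≡⟨ j+j≡j*2 j ⟨
    j + j               ∎
    where open ≤-Reasoning

halfWindow⁺ : ∀ {m i} → i < m ∸ m / 2 → m < (suc (m / 2) + i) + (suc (m / 2) + i) × suc (m / 2) + i ≤ m
halfWindow⁺ {m} {i} i< = Equivalence.from m<j+j⇔m/2<j (s≤s (m≤m+n (m / 2) i)) , (begin
  suc (m / 2) + i       ≡⟨ +-suc (m / 2) i ⟨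
  m / 2 + suc i         ≤⟨ +-monoʳ-≤ (m / 2) i< ⟩
  m / 2 + (m ∸ m / 2)   ≡⟨ m+[n∸m]≡n (m/n≤m m 2) ⟩
  m                     ∎)
  where open ≤-Reasoning

halfWindow⁻ : ∀ {m j} → m < j + j → j ≤ m → ∃ λ i → i < m ∸ m / 2 × j ≡ suc (m / 2) + i
halfWindow⁻ {m} {j} m<2j j≤m =
  j ∸ suc (m / 2) , ∸-monoˡ-< (s≤s j≤m) m/2<j , sym (m+[n∸m]≡n m/2<j)
  where m/2<j = Equivalence.to m<j+j⇔m/2<j m<2j

j*n≤r+m*n⇒j≤m : ∀ {r n} j m → r < n → j * n ≤ r + m * n → j ≤ m
j*n≤r+m*n⇒j≤m {r} {n} j m r<n le = ≮⇒≥ λ m<j →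
  <⇒≱ r<n (+-cancelʳ-≤ (m * n) n r (≤-trans (*-monoˡ-≤ n m<j) le))

-- Below, c + c + m * 3 is F + 3 and c + j * 3 the Apéry element in the class other than that of F.
window-< : ∀ c m j → c + c + m * 3 < (c + j * 3) + (c + j * 3) ⇔ m < j + j
window-< c m j = mk⇔
  (λ lt → *-cancelʳ-< 3 m (j + j)
            (+-cancelˡ-< (c + c) (m * 3) ((j + j) * 3) (subst (c + c + m * 3 <_) (double c j) lt)))
  (λ lt → subst (c + c + m * 3 <_) (sym (double c j)) (+-monoʳ-< (c + c) (*-monoˡ-< 3 lt)))
  where
  double : ∀ c j → (c + j * 3) + (c + j * 3) ≡ c + c + (j + j) * 3
  double = solve-∀

window-≤ : ∀ {c} m j → c < 3 → c + j * 3 ≤ c + c + m * 3 ⇔ j ≤ m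
window-≤ {c} m j c<3 = mk⇔
  (λ le → j*n≤r+m*n⇒j≤m j m c<3
            (+-cancelˡ-≤ c (j * 3) (c + m * 3) (subst (c + j * 3 ≤_) (+-assoc c c (m * 3)) le)))
  (λ j≤m → subst (c + j * 3 ≤_) (sym (+-assoc c c (m * 3)))
            (+-monoʳ-≤ c (≤-trans (*-monoˡ-≤ 3 j≤m) (m≤n+m (m * 3) c))))

rep-res : ∀ {c} → c < 3 → rep (res c) ≡ c
rep-res {0} _ = refl
rep-res {1} _ = refl
rep-res {2} _ = refl
rep-res {suc (suc (suc _))} (s≤s (s≤s (s≤s ())))

numberOf-window : ∀ {P : Subset → Set} (g : ℕ → Subset) c m → c < 3 →
  (∀ {w w′} → res w ≡ res c → res w′ ≡ res c → g w ≈S g w′ → w ≡ w′) →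
  (∀ w → res w ≡ res c → c + c + m * 3 < w + w → w ≤ c + c + m * 3 → P (g w)) →
  (∀ S → P S → ∃ λ w → res w ≡ res c × c + c + m * 3 < w + w × w ≤ c + c + m * 3 × S ≈S g w) →
  NumberOf P (m ∸ m / 2)
numberOf-window {P} g c m c<3 g-injective P-g complete =
  numberOf-enumeration (g ∘ w) (m ∸ m / 2) w∘g-injective P-g∘w complete′
  where
  w : ℕ → ℕ
  w i = c + (suc (m / 2) + i) * 3
  res-w : ∀ i → res (w i) ≡ res c
  res-w i = res-+*3 c (suc (m / 2) + i)
  w∘g-injective : ∀ {i i′} → g (w i) ≈S g (w i′) → i ≡ i′
  w∘g-injective {i} {i′} g≈ = +-cancelˡ-≡ (suc (m / 2)) i i′
    (*-cancelʳ-≡ _ _ 3 (+-cancelˡ-≡ c _ _ (g-injective (res-w i) (res-w i′) g≈)))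
  P-g∘w : ∀ {i} → i < m ∸ m / 2 → P (g (w i))
  P-g∘w {i} i< = P-g (w i) (res-w i)
    (Equivalence.from (window-< c m _) (proj₁ (halfWindow⁺ i<)))
    (Equivalence.from (window-≤ m _ c<3) (proj₂ (halfWindow⁺ i<)))
  complete′ : ∀ S → P S → ∃ λ i → i < m ∸ m / 2 × S ≈S g (w i)
  complete′ S PS =
    let (x , res-x , N<2x , x≤N , S≈) = complete S PS
        (j , x≡) = res≡⇒rep+*3 res-x
        x≡c+j*3 = trans x≡ (cong (_+ j * 3) (rep-res c<3))
        (i , i< , j≡) = halfWindow⁻
          (Equivalence.to (window-< c m j) (subst (λ y → c + c + m * 3 < y + y) x≡c+j*3 N<2x))
          (Equivalence.to (window-≤ m j c<3) (subst (_≤ c + c + m * 3) x≡c+j*3 x≤N))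
    in i , i< , subst (λ y → S ≈S g y) (trans x≡c+j*3 (cong (λ k → c + k * 3) j≡)) S≈

⟨3⟩-apery-injective : ∀ {a b a′ b′} → res a ≡ 1₃ → res b ≡ 2₃ → res a′ ≡ 1₃ → res b′ ≡ 2₃ →
  ⟨3, a , b ⟩ ≈S ⟨3, a′ , b′ ⟩ → ∀ ρ → apery a b ρ ≡ apery a′ b′ ρ
⟨3⟩-apery-injective {a} {b} {a′} {b′} res-a res-b res-a′ res-b′ S≈S′ ρ = ≤-antisym
  (∈⟨3⟩⁻ (S′.res-apery ρ) (∈-resp-≈⁻ S≈S′ {n = apery a′ b′ ρ} (S′.apery-∈⟨3⟩ ρ)))
  (∈⟨3⟩⁻ (S.res-apery ρ) (∈-resp-≈ S≈S′ {n = apery a b ρ} (S.apery-∈⟨3⟩ ρ)))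
  where
  module S  = WithResidues {a} {b} res-a res-b
  module S′ = WithResidues {a′} {b′} res-a′ res-b′

F+3<2[F+3] : ∀ F → F + 3 < (F + 3) + (F + 3)
F+3<2[F+3] F = m<m+n (F + 3) (≤-trans (s≤s z≤n) (m≤n+m 3 F))

module _ {F : ℕ} where

  numberOf-res₁ : ∀ m → res F ≡ 1₃ → F + 3 ≡ 2 + 2 + m * 3 → NumberOf (IsMED3Frob F) (m ∸ m / 2)
  numberOf-res₁ m res-F F+3≡ = numberOf-window (λ w → ⟨3, F + 3 , w ⟩) 2 m (s≤s (s≤s (s≤s z≤n)))
    (λ {w} {w′} res-w res-w′ ≈ →
      ⟨3⟩-apery-injective {F + 3} {w} {F + 3} {w′} res-F+3 res-w res-F+3 res-w′ ≈ 2₃)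
    (λ w res-w N<2w w≤N → isMED3FrobApery⇒isMED3Frob {F} {F + 3} {w} (record
      { res-a       = res-F+3
      ; res-b       = res-w
      ; a<b+b       = subst (_< w + w) (sym F+3≡) N<2w
      ; b<a+a       = ≤-<-trans (subst (w ≤_) (sym F+3≡) w≤N) (F+3<2[F+3] F)
      ; apery-frob  = cong (λ ρ → apery (F + 3) w ρ) res-F
      ; apery-bound = λ { 0₃ → z≤n ; 1₃ → ≤-refl ; 2₃ → subst (w ≤_) (sym F+3≡) w≤N } }))
    complete
    where
    res-F+3 : res (F + 3) ≡ 1₃
    res-F+3 = trans (res-+*3 F 1) res-F
    complete : ∀ S → IsMED3Frob F S →
      ∃ λ w → res w ≡ 2₃ × 2 + 2 + m * 3 < w + w × w ≤ 2 + 2 + m * 3 × S ≈S ⟨3, F + 3 , w ⟩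
    complete S M =
      let (a , b , A , S≈) = isMED3Frob⇒≈⟨3⟩ M
          open IsMED3FrobApery A
          a≡F+3 = trans (cong (apery a b) (sym res-F)) apery-frob
      in b , res-b , subst (_< b + b) (trans a≡F+3 F+3≡) a<b+b , subst (b ≤_) F+3≡ (apery-bound 2₃)
         , subst (λ x → S ≈S ⟨3, x , b ⟩) a≡F+3 S≈

  numberOf-res₂ : ∀ m → res F ≡ 2₃ → F + 3 ≡ 1 + 1 + m * 3 → NumberOf (IsMED3Frob F) (m ∸ m / 2)
  numberOf-res₂ m res-F F+3≡ = numberOf-window (λ w → ⟨3, w , F + 3 ⟩) 1 m (s≤s (s≤s z≤n))
    (λ {w} {w′} res-w res-w′ ≈ →
      ⟨3⟩-apery-injective {w} {F + 3} {w′} {F + 3} res-w res-F+3 res-w′ res-F+3 ≈ 1₃)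
    (λ w res-w N<2w w≤N → isMED3FrobApery⇒isMED3Frob {F} {w} {F + 3} (record
      { res-a       = res-w
      ; res-b       = res-F+3
      ; a<b+b       = ≤-<-trans (subst (w ≤_) (sym F+3≡) w≤N) (F+3<2[F+3] F)
      ; b<a+a       = subst (_< w + w) (sym F+3≡) N<2w
      ; apery-frob  = cong (λ ρ → apery w (F + 3) ρ) res-F
      ; apery-bound = λ { 0₃ → z≤n ; 1₃ → subst (w ≤_) (sym F+3≡) w≤N ; 2₃ → ≤-refl } }))
    complete
    where
    res-F+3 : res (F + 3) ≡ 2₃
    res-F+3 = trans (res-+*3 F 1) res-F
    complete : ∀ S → IsMED3Frob F S →
      ∃ λ w → res w ≡ 1₃ × 1 + 1 + m * 3 < w + w × w ≤ 1 + 1 + m * 3 × S ≈S ⟨3, w , F + 3 ⟩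
    complete S M =
      let (a , b , A , S≈) = isMED3Frob⇒≈⟨3⟩ M
          open IsMED3FrobApery A
          b≡F+3 = trans (cong (apery a b) (sym res-F)) apery-frob
      in a , res-a , subst (_< a + a) (trans b≡F+3 F+3≡) b<a+a , subst (a ≤_) F+3≡ (apery-bound 1₃)
         , subst (λ x → S ≈S ⟨3, a , x ⟩) b≡F+3 S≈

[m+kn]/n≡m/n+k : ∀ m k n .{{_ : NonZero n}} → (m + k * n) / n ≡ m / n + k
[m+kn]/n≡m/n+k m k n = trans (+-distrib-/-∣ʳ m (divides k refl)) (cong (m / n +_) (m*n/n≡m k n))

ceilDiv6[F+2]≡ : ∀ F → ceilDiv6 (F + 2) ≡ suc ((F + 1) / 3 / 2)
ceilDiv6[F+2]≡ F = begin
  (F + 2 + 5) / 6              ≡⟨ /-congˡ (shift F) ⟩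
  (F + 1 + 2 * 3) / 6          ≡⟨ m/n/o≡m/[n*o] (F + 1 + 2 * 3) 3 2 ⟨
  (F + 1 + 2 * 3) / 3 / 2      ≡⟨ cong (_/ 2) ([m+kn]/n≡m/n+k (F + 1) 2 3) ⟩
  ((F + 1) / 3 + 1 * 2) / 2    ≡⟨ [m+kn]/n≡m/n+k ((F + 1) / 3) 1 2 ⟩
  (F + 1) / 3 / 2 + 1          ≡⟨ +-comm _ 1 ⟩
  suc ((F + 1) / 3 / 2)        ∎
  where
  open ≡-Reasoning
  shift : ∀ F → F + 2 + 5 ≡ F + 1 + 2 * 3
  shift = solve-∀

F+3≡[res₁] : ∀ {F} → res F ≡ 1₃ → F + 3 ≡ 2 + 2 + (F + 1) / 3 * 3
F+3≡[res₁] {F} res-F with p , refl ← res≡⇒rep+*3 {F} res-F = begin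
  1 + p * 3 + 3                      ≡⟨ e₁ p ⟩
  2 + 2 + p * 3                      ≡⟨ cong (λ q → 2 + 2 + q * 3) ([m+kn]/n≡m/n+k 2 p 3) ⟨
  2 + 2 + (2 + p * 3) / 3 * 3        ≡⟨ cong (λ x → 2 + 2 + x / 3 * 3) (e₂ p) ⟩
  2 + 2 + (1 + p * 3 + 1) / 3 * 3    ∎
  where
  open ≡-Reasoning
  e₁ : ∀ p → 1 + p * 3 + 3 ≡ 2 + 2 + p * 3
  e₁ = solve-∀
  e₂ : ∀ p → 2 + p * 3 ≡ 1 + p * 3 + 1
  e₂ = solve-∀

F+3≡[res₂] : ∀ {F} → res F ≡ 2₃ → F + 3 ≡ 1 + 1 + (F + 1) / 3 * 3
F+3≡[res₂] {F} res-F with p , refl ← res≡⇒rep+*3 {F} res-F = begin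
  2 + p * 3 + 3                      ≡⟨ e₁ p ⟩
  1 + 1 + suc p * 3                  ≡⟨ cong (λ q → 1 + 1 + q * 3) ([m+kn]/n≡m/n+k 0 (suc p) 3) ⟨
  1 + 1 + (0 + suc p * 3) / 3 * 3    ≡⟨ cong (λ x → 1 + 1 + x / 3 * 3) (e₂ p) ⟩
  1 + 1 + (2 + p * 3 + 1) / 3 * 3    ∎
  where
  open ≡-Reasoning
  e₁ : ∀ p → 2 + p * 3 + 3 ≡ 1 + 1 + suc p * 3
  e₁ = solve-∀
  e₂ : ∀ p → 0 + suc p * 3 ≡ 2 + p * 3 + 1
  e₂ = solve-∀

mainTheorem5 : (F : ℕ) → 0 < F → F % 3 ≢ 0 →
    NumberOf (IsMED3Frob F) (((F + 1) / 3) + 1 ∸ ceilDiv6 (F + 2))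
mainTheorem5 F _ F%3≢0 = subst (NumberOf (IsMED3Frob F)) count≡ (byClass (res F) refl)
  where
  m = (F + 1) / 3
  byClass : ∀ ρ → res F ≡ ρ → NumberOf (IsMED3Frob F) (m ∸ m / 2)
  byClass 0₃ res-F with k , F≡ ← res≡⇒rep+*3 {F} res-F =
    ⊥-elim (F%3≢0 (trans (cong (_% 3) F≡) (m*n%n≡0 k 3)))
  byClass 1₃ res-F = numberOf-res₁ m res-F (F+3≡[res₁] res-F)
  byClass 2₃ res-F = numberOf-res₂ m res-F (F+3≡[res₂] res-F)
  count≡ : m ∸ m / 2 ≡ m + 1 ∸ ceilDiv6 (F + 2)
  count≡ = sym (cong₂ _∸_ (+-comm m 1) (ceilDiv6[F+2]≡ F))
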